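{- For every H-PCL formula $p$, the sequent $p\vdash\lambda(p)$ is provable in PCL if and only if the contract automaton $\llbracket p\rrbracket$ admits agreement.
   Context: Contract automata: fix disjoint sets $\mathbb{R}$ (requests $a$) and $\mathbb{O}$ (offers $\overline a$), idle symbol $\Box$, $\Sigma=\mathbb{R}\cup\mathbb{O}\cup\{\Box\}$, $co$ swapping $a,\overline a$ and fixing $\Box$. $\vec a\in\Sigma^n$ is a request/offer on $\alpha$ if it is $\Box^{n_1}\alpha\Box^{n_2}$ with $\alpha\in\mathbb{R}$/$\mathbb{O}$, a match if $\Box^{n_1}\alpha\Box^{n_2}co(\alpha)\Box^{n_3}$; $\vec a\bowtie\vec b$ iff $\vec a$ is a request or offer on some $\alpha$ and $\vec b$ is respectively an offer or request on $co(\alpha)$. A CA of rank $n$ is $\langle Q,\vec q_0,A^r,A^o,T,F\rangle$, $Q=Q_1\times\cdots\times Q_n$, transition labels in $(A^r\cup A^o\cup\{\Box\})^n$ being requests, offers or matches, idle components not changing state; its language consists of label words of paths from $\vec q_0$ to $F$. Product of CAs of ranks $r_i$: states are concatenations, initial/final componentwise, transitions are either (i) a joint move of components $i<j$ with complementary labels, label $\Box^u\vec a_i\Box^v\vec a_j\Box^z$ padded to total rank, or (ii) a move of a single component $i$ padded by idles, allowed only if no other component has, in its current state, a transition with label complementary to $\vec a_i$. $\boxtimes$ (a-product) is the product of all rank-1 projections of the operands. Observable: non-idle entry for requests/offers, $\tau$ for matches; $\mathfrak{A}$ = words of rank $>1$ whose observable lies in $(\mathbb{O}\cup\{\tau\})^*$;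 a CA admits agreement iff its language meets $\mathfrak{A}$. H-PCL formulae: $p::=\bigwedge_{i\in I}\alpha_i$, $\alpha::=\bigwedge_{j\in J}a_j\mid(\bigwedge_{j\in J}a_j)\rightarrow b\mid(\bigwedge_{j\in J}a_j)\twoheadrightarrow b$, $|I|\ge2$, $|J|\ge1$, distinct $a_j$, $a_j\ne b$. $\lambda(p)$ is the conjunction of all atoms in $p$. Translation with $\mathcal{P}=\{q\cup\{\ast\}\mid q\subseteq J\}$: $\llbracket\bigwedge_i\alpha_i\rrbracket=\boxtimes_i\llbracket\alpha_i\rrbracket$; $\llbracket\bigwedge_j a_j\rrbracket$ has the single (initial and final) state $\{\ast\}$ and loops $(\{\ast\},\overline{a_j},\{\ast\})$; $\llbracket(\bigwedge_j a_j)\rightarrow b\rrbracket$ has states $\mathcal{P}$, initial $J\cup\{\ast\}$, final $\{\ast\}$, transitions $(J'\cup\{j\},a_j,J')$ ($j\in J$, $j\notin J'\in\mathcal P$) and $(\{\ast\},\overline b,\{\ast\})$; $\llbracket(\bigwedge_j a_j)\twoheadrightarrow b\rrbracket$ is the same but with loops $(q,\overline b,q)$ at every $q\in\mathcal{P}$ instead of only at $\{\ast\}$. PCL sequent calculus (formulae built from atoms, $\bot,\top,\neg,\vee,\wedge,\rightarrow,\twoheadrightarrow$): $id$: $\Gamma,p\vdash p$; $\wedge L1$: from $\Gamma,p\wedge q,p\vdash r$ infer $\Gamma,p\wedge q\vdash r$; $\wedge L2$: from $\Gamma,p\wedge q,q\vdash r$ infer $\Gamma,p\wedge q\vdash r$;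 $\wedge R$: from $\Gamma\vdash p$ and $\Gamma\vdash q$ infer $\Gamma\vdash p\wedge q$; $\vee L$: from $\Gamma,p\vee q,p\vdash r$ and $\Gamma,p\vee q,q\vdash r$ infer $\Gamma,p\vee q\vdash r$; $\vee R1/2$: from $\Gamma\vdash p$ (resp. $q$) infer $\Gamma\vdash p\vee q$; $cut$: from $\Gamma\vdash p$ and $\Gamma,p\vdash q$ infer $\Gamma\vdash q$; $\rightarrow L$: from $\Gamma,p\rightarrow q\vdash p$ and $\Gamma,p\rightarrow q,q\vdash r$ infer $\Gamma,p\rightarrow q\vdash r$; $\rightarrow R$: from $\Gamma,p\vdash q$ infer $\Gamma\vdash p\rightarrow q$; $\neg L$: from $\Gamma,\neg p\vdash p$ infer $\Gamma,\neg p\vdash r$; $\neg R$: from $\Gamma,p\vdash\bot$ infer $\Gamma\vdash\neg p$; $\bot L$: $\Gamma,\bot\vdash p$; $\top R$: $\Gamma\vdash\top$; $weakR$: from $\Gamma\vdash\bot$ infer $\Gamma\vdash p$; $Zero$: from $\Gamma\vdash q$ infer $\Gamma\vdash p\twoheadrightarrow q$; $Fix$: from $\Gamma,p\twoheadrightarrow q,r\vdash p$ and $\Gamma,p\twoheadrightarrow q,q\vdash r$ infer $\Gamma,p\twoheadrightarrow q\vdash r$; $PrePost$: from $\Gamma,p\twoheadrightarrow q,p'\vdash p$ and $\Gamma,p\twoheadrightarrow q,q\vdash q'$ infer $\Gamma,p\twoheadrightarrow q\vdash p'\twoheadrightarrow q'$. -}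

module Defs where

open import Data.Nat using (ℕ; zero; suc; _≤_; _<_)
open import Data.Fin as Fin using (Fin)
open import Data.Fin.Subset as S using (Subset; ⁅_⁆; _∪_; _∉_)
open import Data.Vec as Vec using (Vec; lookup)
open import Data.List as List using (List; []; _∷_; _++_; [_]; length)
open import Data.List.NonEmpty as L⁺ using (List⁺)
open import Data.List.Membership.Propositional as LM using (_∈_)
open import Data.List.Relation.Unary.All using (All)
open import Data.List.Relation.Unary.Unique.Propositional using (Unique)
open import Data.Product using (Σ; Σ-syntax; _×_)
open import Data.Sum using (_⊎_)
open import Relation.Binary.PropositionalEquality using (_≡_; _≢_)
open import Relation.Nullary using (¬_)
open import Data.Unit using (tt) renaming (⊤ to Unit)

Atom : Set
Atom = ℕ

infixr 6 _∧_
infixr 5 _∨_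
infixr 4 _⇒_ _↠_

data Formula : Set where
  atom : Atom → Formula
  ⊥f ⊤f : Formula
  ¬f : Formula → Formula
  _∨_ _∧_ _⇒_ _↠_ : Formula → Formula → Formula

-- Contexts are lists read as sets: "Γ , p" in a conclusion is rendered
-- as "p ∈ Γ", and "Γ , p" in a premise as "p ∷ Γ".
Ctx : Set
Ctx = List Formula

infix 2 _⊢_

data _⊢_ (Γ : Ctx) : Formula → Set where
  id      : ∀ {p} → p ∈ Γ → Γ ⊢ p
  ∧L1     : ∀ {p q r} → (p ∧ q) ∈ Γ → (p ∷ Γ) ⊢ r → Γ ⊢ r
  ∧L2     : ∀ {p q r} → (p ∧ q) ∈ Γ → (q ∷ Γ) ⊢ r → Γ ⊢ r
  ∧R      : ∀ {p q} → Γ ⊢ p → Γ ⊢ q → Γ ⊢ p ∧ q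
  ∨L      : ∀ {p q r} → (p ∨ q) ∈ Γ → (p ∷ Γ) ⊢ r → (q ∷ Γ) ⊢ r → Γ ⊢ r
  ∨R1     : ∀ {p q} → Γ ⊢ p → Γ ⊢ p ∨ q
  ∨R2     : ∀ {p q} → Γ ⊢ q → Γ ⊢ p ∨ q
  cut     : ∀ {p q} → Γ ⊢ p → (p ∷ Γ) ⊢ q → Γ ⊢ q
  ⇒L      : ∀ {p q r} → (p ⇒ q) ∈ Γ → Γ ⊢ p → (q ∷ Γ) ⊢ r → Γ ⊢ r
  ⇒R      : ∀ {p q} → (p ∷ Γ) ⊢ q → Γ ⊢ p ⇒ q
  ¬L      : ∀ {p r} → ¬f p ∈ Γ → Γ ⊢ p → Γ ⊢ r
  ¬R      : ∀ {p} → (p ∷ Γ) ⊢ ⊥f → Γ ⊢ ¬f p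
  ⊥L      : ∀ {p} → ⊥f ∈ Γ → Γ ⊢ p
  ⊤R      : Γ ⊢ ⊤f
  weakR   : ∀ {p} → Γ ⊢ ⊥f → Γ ⊢ p
  Zero    : ∀ {p q} → Γ ⊢ q → Γ ⊢ p ↠ q
  Fix     : ∀ {p q r} → (p ↠ q) ∈ Γ → (r ∷ Γ) ⊢ p → (q ∷ Γ) ⊢ r → Γ ⊢ r
  PrePost : ∀ {p q p' q'} → (p ↠ q) ∈ Γ → (p' ∷ Γ) ⊢ p → (q ∷ Γ) ⊢ q'
          → Γ ⊢ p' ↠ q'

⋀ : List Formula → Formula
⋀ []           = ⊤f     -- never used: all lists below are nonempty
⋀ (x ∷ [])     = x
⋀ (x ∷ y ∷ xs) = x ∧ ⋀ (y ∷ xs)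

data HAlpha : Set where
  hconj : (J : List⁺ Atom) → Unique (L⁺.toList J) → HAlpha
  himp  : (J : List⁺ Atom) → Unique (L⁺.toList J) → (b : Atom) → b LM.∉ L⁺.toList J → HAlpha
  hfix  : (J : List⁺ Atom) → Unique (L⁺.toList J) → (b : Atom) → b LM.∉ L⁺.toList J → HAlpha

record HPCL : Set where
  constructor hpcl
  field
    alphas : List HAlpha
    two≤   : 2 ≤ length alphas
open HPCL public

atoms : List⁺ Atom → List Formula
atoms J = List.map atom (L⁺.toList J)

⟦_⟧α : HAlpha → Formula
⟦ hconj J _ ⟧α     = ⋀ (atoms J)
⟦ himp J _ b _ ⟧α  = ⋀ (atoms J) ⇒ atom b
⟦ hfix J _ b _ ⟧α  = ⋀ (atoms J) ↠ atom b

toPCL : HPCL → Formula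
toPCL p = ⋀ (List.map ⟦_⟧α (alphas p))

atomsα : HAlpha → List Atom
atomsα (hconj J _)     = L⁺.toList J
atomsα (himp J _ b _)  = L⁺.toList J ++ [ b ]
atomsα (hfix J _ b _)  = L⁺.toList J ++ [ b ]

λp : HPCL → Formula
λp p = ⋀ (List.map atom (List.concatMap atomsα (alphas p)))

-- Σ = R ∪ O ∪ {□}: req a is the request a, off a is the offer ā.
data Act : Set where
  req off : Atom → Act
  idle : Act

co : Act → Act
co (req a) = off a
co (off a) = req a
co idle    = idle

Label : ℕ → Set
Label m = Fin m → Act

RequestOn : ∀ {m} → Label m → Atom → Set
RequestOn {m} v α = Σ[ i ∈ Fin m ] (v i ≡ req α × (∀ k → k ≢ i → v k ≡ idle))

OfferOn : ∀ {m} → Label m → Atom → Set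
OfferOn {m} v α = Σ[ i ∈ Fin m ] (v i ≡ off α × (∀ k → k ≢ i → v k ≡ idle))

Match : ∀ {m} → Label m → Set
Match {m} v = Σ[ i ∈ Fin m ] Σ[ j ∈ Fin m ] (i Fin.< j × Σ[ x ∈ Act ]
  (x ≢ idle × v i ≡ x × v j ≡ co x × (∀ k → k ≢ i → k ≢ j → v k ≡ idle)))

_⋈_ : ∀ {m m'} → Label m → Label m' → Set
v ⋈ w = Σ[ α ∈ Atom ] ((RequestOn v α × OfferOn w α) ⊎ (OfferOn v α × RequestOn w α))

-- A contract automaton of rank n (the alphabets A^r, A^o are left implicit).
record CA (n : ℕ) : Set₁ where
  field
    Q  : Set
    q0 : Q
    T  : Q → Label n → Q → Set
    F  : Q → Set
open CA public

data Path {n} (A : CA n) : Q A → List (Label n) → Q A → Set where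
  []  : ∀ {q} → Path A q [] q
  _∷_ : ∀ {q l q' w q''} → T A q l q' → Path A q' w q'' → Path A q (l ∷ w) q''

Lang : ∀ {n} → CA n → List (Label n) → Set
Lang A w = Σ[ q ∈ Q A ] (Path A (q0 A) w q × F A q)

data Obs : Set where
  act : Act → Obs
  τ   : Obs

data Observable {m} (v : Label m) : Obs → Set where
  obsReq   : ∀ {α} → RequestOn v α → Observable v (act (req α))
  obsOff   : ∀ {α} → OfferOn v α → Observable v (act (off α))
  obsMatch : Match v → Observable v τ

data OfferOrτ : Obs → Set where
  offer : ∀ {α} → OfferOrτ (act (off α))
  tau   : OfferOrτ τ

Agreement : ∀ {n} → List (Label n) → Set
Agreement {n} w = 1 < n × All (λ v → Σ[ o ∈ Obs ] (Observable v o × OfferOrτ o)) w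

AdmitsAgreement : ∀ {n} → CA n → Set
AdmitsAgreement A = Σ[ w ∈ List (Label _) ] (Lang A w × Agreement w)

-- Product of rank-1 CAs A₀ … A_{n-1} (rank-1 projections of rank-1 CAs are
-- the CAs themselves, so this is also their a-product ⊠).
module _ {n : ℕ} (A : Fin n → CA 1) where
  private
    St : Set
    St = (i : Fin n) → Q (A i)

  Joint : St → Label n → St → Set
  Joint s l s' = Σ[ i ∈ Fin n ] Σ[ j ∈ Fin n ] (i Fin.< j ×
    Σ[ a ∈ Label 1 ] Σ[ b ∈ Label 1 ] (a ⋈ b
      × T (A i) (s i) a (s' i) × T (A j) (s j) b (s' j)
      × l i ≡ a Fin.zero × l j ≡ b Fin.zero
      × (∀ k → k ≢ i → k ≢ j → l k ≡ idle × s' k ≡ s k)))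

  Single : St → Label n → St → Set
  Single s l s' = Σ[ i ∈ Fin n ] Σ[ a ∈ Label 1 ]
      (T (A i) (s i) a (s' i) × l i ≡ a Fin.zero
      × (∀ k → k ≢ i → l k ≡ idle × s' k ≡ s k)
      × ¬ (Σ[ k ∈ Fin n ] (k ≢ i × Σ[ b ∈ Label 1 ] Σ[ t ∈ Q (A k) ]
              (T (A k) (s k) b t × a ⋈ b))))

  ⊠ : CA n
  ⊠ = record
    { Q  = St
    ; q0 = λ i → q0 (A i)
    ; T  = λ s l s' → Joint s l s' ⊎ Single s l s'
    ; F  = λ s → ∀ i → F (A i) (s i)
    }

-- states of the form q ∪ {∗} with q ⊆ J are represented by q : Subset |J|
module _ (J : List⁺ Atom) where
  private
    k : ℕ
    k = length (L⁺.toList J)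
    aJ : Vec Atom k
    aJ = Vec.fromList (L⁺.toList J)

  ⟦conj⟧ : CA 1
  ⟦conj⟧ = record
    { Q = Unit
    ; q0 = tt
    ; T = λ q l q' → Σ[ j ∈ Fin k ] l Fin.zero ≡ off (lookup aJ j)
    ; F = λ _ → Unit
    }

  reqStep : Subset k → Label 1 → Subset k → Set
  reqStep q l q' = Σ[ j ∈ Fin k ] (j ∉ q' × q ≡ q' ∪ ⁅ j ⁆ × l Fin.zero ≡ req (lookup aJ j))

  ⟦imp⟧ : Atom → CA 1
  ⟦imp⟧ b = record
    { Q = Subset k
    ; q0 = S.⊤
    ; T = λ q l q' → reqStep q l q'
                   ⊎ (q ≡ S.⊥ × q' ≡ S.⊥ × l Fin.zero ≡ off b)
    ; F = λ q → q ≡ S.⊥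
    }

  ⟦fix⟧ : Atom → CA 1
  ⟦fix⟧ b = record
    { Q = Subset k
    ; q0 = S.⊤
    ; T = λ q l q' → reqStep q l q'
                   ⊎ (q' ≡ q × l Fin.zero ≡ off b)
    ; F = λ q → q ≡ S.⊥
    }

⟦_⟧CAα : HAlpha → CA 1
⟦ hconj J _ ⟧CAα    = ⟦conj⟧ J
⟦ himp J _ b _ ⟧CAα = ⟦imp⟧ J b
⟦ hfix J _ b _ ⟧CAα = ⟦fix⟧ J b

⟦_⟧CA : (p : HPCL) → CA (length (alphas p))
⟦ p ⟧CA = ⊠ (λ i → ⟦ List.lookup (alphas p) i ⟧CAα)

-- Both sides say that every atom of p lies in the least set D of atoms closed under the conjuncts:
-- the atoms of a conjunction ⋀J are in D, the consequent b of (⋀J) → b is in D once J ⊆ D, and the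
-- consequent b of (⋀J) ↠ b is in D outright.  Reading p ↠ q as q is sound for PCL, so a proof of
-- p ⊢ λ(p) puts every atom in D; conversely one Fix per ↠-conjunct, cutting on λ(p) itself,
-- supplies those consequents, and ∧ and → derive the rest.
-- In ⟦p⟧ a request is granted only by a match with an offer, and a component offers only atoms of D
-- as long as its own granted requests lie in D; so along an agreement every granted request is in
-- D, and in a final state all requests have been granted.  Conversely, if all requested atoms are
-- in D, some pending request can always be matched (after first serving the requests of the
-- →-conjunct that is to offer it), and each match lowers the number of pending requests.

module Submission where

open import Defs
open import Data.List using ([_])
open import Function.Bundles using (_⇔_; mk⇔)

open import Function using (_∘_; case_of_)
open import Data.Empty using (⊥; ⊥-elim)
open import Data.Fin as Fin using (Fin; zero; suc)
import Data.Fin.Properties as Fin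
open import Data.Fin.Subset as S using (Subset; inside; outside; ⁅_⁆; _∪_; _-_)
import Data.Fin.Subset.Properties as S
open import Data.List as List using (List; []; _∷_; length; map; concatMap)
open import Data.List.Membership.Propositional using (_∈_; _∉_)
open import Data.List.Membership.Propositional.Properties
  using (∈-map⁺; ∈-map⁻; ∈-++⁺ˡ; ∈-++⁻; ∈-concatMap⁺; ∈-concatMap⁻; ∈-lookup)
open import Data.List.NonEmpty using (List⁺; toList)
open import Data.List.Relation.Binary.Subset.Propositional using (_⊆_)
open import Data.List.Relation.Binary.Subset.Propositional.Properties using (⊆-refl; ∷⁺ʳ)
open import Data.List.Relation.Unary.All using (All; []; _∷_)
open import Data.List.Relation.Unary.Any as Any using (here; there)
open import Data.List.Relation.Unary.Any.Properties using (lookup-index)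
open import Data.Nat as ℕ using (ℕ; _+_; _≤_; _<_; z≤n)
import Data.Nat.Properties as ℕ
open import Data.Nat.Induction using (<-wellFounded)
open import Data.Product using (Σ-syntax; _×_; _,_; proj₁; proj₂)
open import Data.Sum as Sum using (_⊎_; inj₁; inj₂; [_,_]′)
open import Data.Unit using (tt) renaming (⊤ to Unit)
import Data.Vec as Vec
open import Induction.WellFounded using (Acc; acc)
open import Relation.Binary.Definitions using (Tri; tri<; tri≈; tri>)
open import Relation.Binary.PropositionalEquality using (_≡_; _≢_; refl; sym; trans; cong; subst)
open import Relation.Nullary using (yes; no)

weaken : ∀ {Γ Δ p} → Γ ⊆ Δ → Γ ⊢ p → Δ ⊢ p
weaken s (id m)          = id (s m)
weaken s (∧L1 m d)       = ∧L1 (s m) (weaken (∷⁺ʳ _ s) d)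
weaken s (∧L2 m d)       = ∧L2 (s m) (weaken (∷⁺ʳ _ s) d)
weaken s (∧R d e)        = ∧R (weaken s d) (weaken s e)
weaken s (∨L m d e)      = ∨L (s m) (weaken (∷⁺ʳ _ s) d) (weaken (∷⁺ʳ _ s) e)
weaken s (∨R1 d)         = ∨R1 (weaken s d)
weaken s (∨R2 d)         = ∨R2 (weaken s d)
weaken s (cut d e)       = cut (weaken s d) (weaken (∷⁺ʳ _ s) e)
weaken s (⇒L m d e)      = ⇒L (s m) (weaken s d) (weaken (∷⁺ʳ _ s) e)
weaken s (⇒R d)          = ⇒R (weaken (∷⁺ʳ _ s) d)
weaken s (¬L m d)        = ¬L (s m) (weaken s d)
weaken s (¬R d)          = ¬R (weaken (∷⁺ʳ _ s) d)
weaken s (⊥L m)          = ⊥L (s m)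
weaken s ⊤R              = ⊤R
weaken s (weakR d)       = weakR (weaken s d)
weaken s (Zero d)        = Zero (weaken s d)
weaken s (Fix m d e)     = Fix (s m) (weaken (∷⁺ʳ _ s) d) (weaken (∷⁺ʳ _ s) e)
weaken s (PrePost m d e) = PrePost (s m) (weaken (∷⁺ʳ _ s) d) (weaken (∷⁺ʳ _ s) e)

⋀-elim : ∀ {Γ p} (ps : List Formula) → Γ ⊢ ⋀ ps → p ∈ ps → Γ ⊢ p
⋀-elim (q ∷ [])     d (here refl) = d
⋀-elim (q ∷ r ∷ ps) d (here refl) = cut d (∧L1 (here refl) (id (here refl)))
⋀-elim (q ∷ r ∷ ps) d (there m)   = ⋀-elim (r ∷ ps) (cut d (∧L2 (here refl) (id (here refl)))) m

⋀-intro : ∀ {Γ} (ps : List Formula) → (∀ {p} → p ∈ ps → Γ ⊢ p) → Γ ⊢ ⋀ ps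
⋀-intro []           h = ⊤R
⋀-intro (q ∷ [])     h = h (here refl)
⋀-intro (q ∷ r ∷ ps) h = ∧R (h (here refl)) (⋀-intro (r ∷ ps) (h ∘ there))

⋀-atoms-elim : ∀ {Γ a} (xs : List Atom) → Γ ⊢ ⋀ (map atom xs) → a ∈ xs → Γ ⊢ atom a
⋀-atoms-elim xs d a∈ = ⋀-elim (map atom xs) d (∈-map⁺ atom a∈)

⋀-atoms-intro : ∀ {Γ} (xs : List Atom) → (∀ {a} → a ∈ xs → Γ ⊢ atom a) → Γ ⊢ ⋀ (map atom xs)
⋀-atoms-intro xs h = ⋀-intro (map atom xs) λ p∈ → case ∈-map⁻ atom p∈ of λ { (a , a∈ , refl) → h a∈ }

⇒-elim : ∀ {Γ p q} → Γ ⊢ p ⇒ q → Γ ⊢ p → Γ ⊢ q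
⇒-elim d e = cut d (⇒L (here refl) (weaken there e) (id (here refl)))

↠-elim : ∀ {Γ p q r} → Γ ⊢ p ↠ q → (r ∷ Γ) ⊢ p → (q ∷ Γ) ⊢ r → Γ ⊢ r
↠-elim d e g = cut d (Fix (here refl) (weaken (∷⁺ʳ _ there) e) (weaken (∷⁺ʳ _ there) g))

module Valuation (V : Atom → Set) where

  -- Reading p ↠ q as q validates every rule: Fix and PrePost only ever use the consequent.
  ⟦_⟧ : Formula → Set
  ⟦ atom a ⟧ = V a
  ⟦ ⊥f ⟧     = ⊥
  ⟦ ⊤f ⟧     = Unit
  ⟦ ¬f p ⟧   = ⟦ p ⟧ → ⊥
  ⟦ p ∨ q ⟧  = ⟦ p ⟧ ⊎ ⟦ q ⟧
  ⟦ p ∧ q ⟧  = ⟦ p ⟧ × ⟦ q ⟧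
  ⟦ p ⇒ q ⟧  = ⟦ p ⟧ → ⟦ q ⟧
  ⟦ p ↠ q ⟧  = ⟦ q ⟧

  Valid : Ctx → Set
  Valid Γ = ∀ {p} → p ∈ Γ → ⟦ p ⟧

  _∷ᵛ_ : ∀ {Γ p} → ⟦ p ⟧ → Valid Γ → Valid (p ∷ Γ)
  (v ∷ᵛ ρ) (here refl) = v
  (v ∷ᵛ ρ) (there m)   = ρ m

  sound : ∀ {Γ p} → Γ ⊢ p → Valid Γ → ⟦ p ⟧
  sound (id m)          ρ = ρ m
  sound (∧L1 m d)       ρ = sound d (proj₁ (ρ m) ∷ᵛ ρ)
  sound (∧L2 m d)       ρ = sound d (proj₂ (ρ m) ∷ᵛ ρ)
  sound (∧R d e)        ρ = sound d ρ , sound e ρ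
  sound (∨L m d e)      ρ = [ (λ v → sound d (v ∷ᵛ ρ)) , (λ v → sound e (v ∷ᵛ ρ)) ]′ (ρ m)
  sound (∨R1 d)         ρ = inj₁ (sound d ρ)
  sound (∨R2 d)         ρ = inj₂ (sound d ρ)
  sound (cut d e)       ρ = sound e (sound d ρ ∷ᵛ ρ)
  sound (⇒L m d e)      ρ = sound e (ρ m (sound d ρ) ∷ᵛ ρ)
  sound (⇒R d)          ρ = λ v → sound d (v ∷ᵛ ρ)
  sound (¬L m d)        ρ = ⊥-elim (ρ m (sound d ρ))
  sound (¬R d)          ρ = λ v → sound d (v ∷ᵛ ρ)
  sound (⊥L m)          ρ = ⊥-elim (ρ m)
  sound ⊤R              ρ = tt
  sound (weakR d)       ρ = ⊥-elim (sound d ρ)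
  sound (Zero d)        ρ = sound d ρ
  sound (Fix m d e)     ρ = sound e (ρ m ∷ᵛ ρ)
  sound (PrePost m d e) ρ = sound e (ρ m ∷ᵛ ρ)

  ⋀-valid⁺ : (ps : List Formula) → (∀ {p} → p ∈ ps → ⟦ p ⟧) → ⟦ ⋀ ps ⟧
  ⋀-valid⁺ []           h = tt
  ⋀-valid⁺ (q ∷ [])     h = h (here refl)
  ⋀-valid⁺ (q ∷ r ∷ ps) h = h (here refl) , ⋀-valid⁺ (r ∷ ps) (h ∘ there)

  ⋀-valid⁻ : ∀ {p} (ps : List Formula) → ⟦ ⋀ ps ⟧ → p ∈ ps → ⟦ p ⟧
  ⋀-valid⁻ (q ∷ [])     v (here refl) = v
  ⋀-valid⁻ (q ∷ r ∷ ps) v (here refl) = proj₁ v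
  ⋀-valid⁻ (q ∷ r ∷ ps) v (there m)   = ⋀-valid⁻ (r ∷ ps) (proj₂ v) m

  ⋀-atoms-valid⁺ : (xs : List Atom) → (∀ {a} → a ∈ xs → V a) → ⟦ ⋀ (map atom xs) ⟧
  ⋀-atoms-valid⁺ xs h = ⋀-valid⁺ (map atom xs) λ p∈ → case ∈-map⁻ atom p∈ of λ { (a , a∈ , refl) → h a∈ }

  ⋀-atoms-valid⁻ : ∀ {a} (xs : List Atom) → ⟦ ⋀ (map atom xs) ⟧ → a ∈ xs → V a
  ⋀-atoms-valid⁻ xs v a∈ = ⋀-valid⁻ (map atom xs) v (∈-map⁺ atom a∈)

lookup-fromList-∈ : ∀ {A : Set} (xs : List A) i → Vec.lookup (Vec.fromList xs) i ∈ xs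
lookup-fromList-∈ (x ∷ xs) zero    = here refl
lookup-fromList-∈ (x ∷ xs) (suc i) = there (lookup-fromList-∈ xs i)

∈⇒lookup-fromList : ∀ {A : Set} {x} (xs : List A) → x ∈ xs →
                    Σ[ i ∈ Fin (length xs) ] Vec.lookup (Vec.fromList xs) i ≡ x
∈⇒lookup-fromList (y ∷ xs) (here refl) = zero , refl
∈⇒lookup-fromList (y ∷ xs) (there m)   = let (i , e) = ∈⇒lookup-fromList xs m in suc i , e

p-x∪⁅x⁆≡p : ∀ {k} {x : Fin k} {p : Subset k} → x S.∈ p → (p - x) ∪ ⁅ x ⁆ ≡ p
p-x∪⁅x⁆≡p {p = inside Vec.∷ p}  Vec.here      =
  cong (inside Vec.∷_) (trans (S.∪-identityʳ (p S.─ S.⊥)) (S.p─⊥≡p p))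
p-x∪⁅x⁆≡p {p = inside Vec.∷ p}  (Vec.there m) = cong (inside Vec.∷_) (p-x∪⁅x⁆≡p m)
p-x∪⁅x⁆≡p {p = outside Vec.∷ p} (Vec.there m) = cong (outside Vec.∷_) (p-x∪⁅x⁆≡p m)

x∉p-x : ∀ {k} (p : Subset k) x → x S.∉ p - x
x∉p-x (_ Vec.∷ p) (suc x) (Vec.there m) = x∉p-x p x m

req₁ off₁ : Atom → Label 1
req₁ a _ = req a
off₁ a _ = off a

atomAt : (J : List⁺ Atom) → Fin (length (toList J)) → Atom
atomAt J = Vec.lookup (Vec.fromList (toList J))

requests : HAlpha → List Atom
requests (hconj _ _)    = []
requests (himp J _ _ _) = toList J
requests (hfix J _ _ _) = toList J

pending : (α : HAlpha) → Q ⟦ α ⟧CAα → ℕ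
pending (hconj _ _)    _ = 0
pending (himp _ _ _ _) q = S.∣ q ∣
pending (hfix _ _ _ _) q = S.∣ q ∣

RequestStep OfferStep : (α : HAlpha) → Q ⟦ α ⟧CAα → Atom → Set
RequestStep α q a = Σ[ t ∈ Q ⟦ α ⟧CAα ] (T ⟦ α ⟧CAα q (req₁ a) t × pending α t < pending α q)
OfferStep   α q a = Σ[ t ∈ Q ⟦ α ⟧CAα ] (T ⟦ α ⟧CAα q (off₁ a) t × pending α t ≤ pending α q)

requests⊆atomsα : ∀ α {a} → a ∈ requests α → a ∈ atomsα α
requests⊆atomsα (hconj _ _)    ()
requests⊆atomsα (himp J _ _ _) = ∈-++⁺ˡ
requests⊆atomsα (hfix J _ _ _) = ∈-++⁺ˡ

subset-next-request : ∀ J (q : Subset (length (toList J))) →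
  q ≡ S.⊥ ⊎ Σ[ a ∈ Atom ] (a ∈ toList J × Σ[ t ∈ Subset _ ] (reqStep J q (req₁ a) t × S.∣ t ∣ < S.∣ q ∣))
subset-next-request J q with S.nonempty? q
... | yes (j , j∈q) = inj₂ (atomAt J j , lookup-fromList-∈ _ j , q - j ,
                            (j , x∉p-x q j , sym (p-x∪⁅x⁆≡p j∈q) , refl) , S.x∈p⇒∣p-x∣<∣p∣ j∈q)
... | no empty      = inj₁ (S.Empty-unique empty)

next-request : ∀ α q → F ⟦ α ⟧CAα q ⊎ Σ[ a ∈ Atom ] (a ∈ requests α × RequestStep α q a)
next-request (hconj _ _)    q = inj₁ tt
next-request (himp J _ _ _) q =
  Sum.map₂ (λ (a , a∈ , t , step , lt) → a , a∈ , t , inj₁ step , lt) (subset-next-request J q)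
next-request (hfix J _ _ _) q =
  Sum.map₂ (λ (a , a∈ , t , step , lt) → a , a∈ , t , inj₁ step , lt) (subset-next-request J q)

conj-offer : ∀ {α J u a} → α ≡ hconj J u → a ∈ toList J → (q : Q ⟦ α ⟧CAα) → OfferStep α q a
conj-offer {J = J} refl a∈ q =
  let (j , e) = ∈⇒lookup-fromList (toList J) a∈ in tt , (j , cong off (sym e)) , z≤n

imp-offer : ∀ {α J u b nb} → α ≡ himp J u b nb → (q : Q ⟦ α ⟧CAα) → F ⟦ α ⟧CAα q → OfferStep α q b
imp-offer refl q refl = S.⊥ , inj₂ (refl , refl , refl) , ℕ.≤-refl

fix-offer : ∀ {α J u b nb} → α ≡ hfix J u b nb → (q : Q ⟦ α ⟧CAα) → OfferStep α q b
fix-offer refl q = q , inj₂ (refl , refl) , ℕ.≤-refl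

-- q holds the requests still pending, so those outside q have been granted.
Served : (Atom → Set) → (J : List⁺ Atom) → Subset (length (toList J)) → Set
Served D J q = ∀ j → j S.∉ q → D (atomAt J j)

served-⊥ : ∀ {D} J → Served D J S.⊥ → ∀ {a} → a ∈ toList J → D a
served-⊥ {D} J served a∈ =
  let (j , e) = ∈⇒lookup-fromList (toList J) a∈ in subst D e (served j S.∉⊥)

served-step : ∀ {D} J {q l q'} → reqStep J q l q' → Served D J q →
              (∀ {c} → l zero ≡ req c → D c) → Served D J q'
served-step J (j , j∉q' , refl , lab) served requested x x∉q' with x Fin.≟ j
... | yes refl = requested lab
... | no x≢j   = served x λ x∈ →
  [ x∉q' , (λ x∈⁅j⁆ → x≢j (S.x∈⁅y⁆⇒x≡y j x∈⁅j⁆)) ]′ (S.x∈p∪q⁻ _ ⁅ j ⁆ x∈)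

Fulfilled : (Atom → Set) → (α : HAlpha) → Q ⟦ α ⟧CAα → Set
Fulfilled D (hconj _ _)    _ = Unit
Fulfilled D (himp J _ _ _) q = Served D J q
Fulfilled D (hfix J _ _ _) q = Served D J q

fulfilled-initial : ∀ D α → Fulfilled D α (q0 ⟦ α ⟧CAα)
fulfilled-initial D (hconj _ _)          = tt
fulfilled-initial D (himp _ _ _ _) j j∉⊤ = ⊥-elim (j∉⊤ S.∈⊤)
fulfilled-initial D (hfix _ _ _ _) j j∉⊤ = ⊥-elim (j∉⊤ S.∈⊤)

fulfilled-step : ∀ {D} α {q l q'} → T ⟦ α ⟧CAα q l q' → Fulfilled D α q →
                 (∀ {c} → l zero ≡ req c → D c) → Fulfilled D α q'
fulfilled-step (hconj _ _)    _ _ _ = tt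
fulfilled-step (himp J _ _ _) {l = l} (inj₁ step) served requested = served-step J {l = l} step served requested
fulfilled-step (himp J _ _ _) (inj₂ (refl , refl , _)) served _    = served
fulfilled-step (hfix J _ _ _) {l = l} (inj₁ step) served requested = served-step J {l = l} step served requested
fulfilled-step (hfix J _ _ _) (inj₂ (refl , _)) served _           = served

Closed : (Atom → Set) → HAlpha → Set
Closed D (hconj J _)    = ∀ {a} → a ∈ toList J → D a
Closed D (himp J _ b _) = (∀ {a} → a ∈ toList J → D a) → D b
Closed D (hfix _ _ b _) = D b

offer-closed : ∀ {D} α {q l q' c} → Closed D α → Fulfilled D α q →
               T ⟦ α ⟧CAα q l q' → l zero ≡ off c → D c
offer-closed (hconj J _) closed _ (j , lab) e with trans (sym lab) e
... | refl = closed (lookup-fromList-∈ (toList J) j)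
offer-closed (himp J _ _ _) closed _ (inj₁ (_ , _ , _ , lab)) e with trans (sym lab) e
... | ()
offer-closed (himp J _ _ _) closed served (inj₂ (refl , _ , lab)) e with trans (sym lab) e
... | refl = closed (served-⊥ J served)
offer-closed (hfix J _ _ _) closed _ (inj₁ (_ , _ , _ , lab)) e with trans (sym lab) e
... | ()
offer-closed (hfix J _ _ _) closed _ (inj₂ (_ , lab)) e with trans (sym lab) e
... | refl = closed

atoms-closed : ∀ {D} α {q} → Closed D α → Fulfilled D α q → F ⟦ α ⟧CAα q →
               ∀ {a} → a ∈ atomsα α → D a
atoms-closed (hconj J _)    closed _ _ = closed
atoms-closed (himp J _ _ _) closed served refl a∈ with ∈-++⁻ (toList J) a∈
... | inj₁ a∈J         = served-⊥ J served a∈J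
... | inj₂ (here refl) = closed (served-⊥ J served)
atoms-closed (hfix J _ _ _) closed served refl a∈ with ∈-++⁻ (toList J) a∈
... | inj₁ a∈J         = served-⊥ J served a∈J
... | inj₂ (here refl) = closed

closed-valid : ∀ {D} α → Closed D α → Valuation.⟦_⟧ D ⟦ α ⟧α
closed-valid {D} (hconj J _)    closed = Valuation.⋀-atoms-valid⁺ D (toList J) closed
closed-valid {D} (himp J _ _ _) closed = λ v → closed (Valuation.⋀-atoms-valid⁻ D (toList J) v)
closed-valid     (hfix _ _ _ _) closed = closed

requestOn-req₁ : ∀ a → RequestOn (req₁ a) a
requestOn-req₁ a = zero , refl , λ { zero z≢z → ⊥-elim (z≢z refl) }

offerOn-off₁ : ∀ a → OfferOn (off₁ a) a
offerOn-off₁ a = zero , refl , λ { zero z≢z → ⊥-elim (z≢z refl) }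

requestOn-head : ∀ {v : Label 1} {a} → RequestOn v a → v zero ≡ req a
requestOn-head (zero , e , _) = e

offerOn-head : ∀ {v : Label 1} {a} → OfferOn v a → v zero ≡ off a
offerOn-head (zero , e , _) = e

⋈-sym : ∀ {m m'} {v : Label m} {w : Label m'} → v ⋈ w → w ⋈ v
⋈-sym (a , inj₁ (r , o)) = a , inj₂ (o , r)
⋈-sym (a , inj₂ (o , r)) = a , inj₁ (r , o)

⋈-request : ∀ {v w : Label 1} {c} → v ⋈ w → v zero ≡ req c → w zero ≡ off c
⋈-request (a , inj₁ (r , o)) e with trans (sym (requestOn-head r)) e
... | refl = offerOn-head o
⋈-request (a , inj₂ (o , r)) e with trans (sym (offerOn-head o)) e
... | ()

Agreeing : ∀ {n} → Label n → Set
Agreeing v = Σ[ o ∈ Obs ] (Observable v o × OfferOrτ o)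

co-idle : ∀ x → co x ≡ idle → x ≡ idle
co-idle idle _ = refl

agreeing-no-lone-request : ∀ {n} {l : Label n} {i c} → Agreeing l → l i ≡ req c →
                           (∀ k → k ≢ i → l k ≡ idle) → ⊥
agreeing-no-lone-request {i = i} (_ , obsOff (k , lk , rest) , offer) li _ with k Fin.≟ i
... | yes refl = case trans (sym li) lk of λ ()
... | no k≢i   = case trans (sym li) (rest i (k≢i ∘ sym)) of λ ()
agreeing-no-lone-request {i = i} (_ , obsMatch (k , k' , k<k' , x , x≢idle , lk , lk' , _) , tau) li others
  with k Fin.≟ i
... | yes refl = x≢idle (co-idle x (trans (sym lk') (others k' (Fin.<⇒≢ k<k' ∘ sym))))
... | no k≢i   = x≢idle (trans (sym lk) (others k k≢i))

update : ∀ {n} {P : Fin n → Set} → ((x : Fin n) → P x) → (i : Fin n) → P i → (x : Fin n) → P x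
update s i t x with i Fin.≟ x
... | yes refl = t
... | no _     = s x

update-same : ∀ {n} {P : Fin n → Set} (s : (x : Fin n) → P x) i t → update s i t i ≡ t
update-same s i t with i Fin.≟ i
... | yes refl = refl
... | no i≢i   = ⊥-elim (i≢i refl)

update-other : ∀ {n} {P : Fin n → Set} (s : (x : Fin n) → P x) i t x → x ≢ i → update s i t x ≡ s x
update-other s i t x x≢i with i Fin.≟ x
... | yes refl = ⊥-elim (x≢i refl)
... | no _     = refl

update₂ : ∀ {n} {P : Fin n → Set} → ((x : Fin n) → P x) →
          (i : Fin n) → P i → (k : Fin n) → P k → (x : Fin n) → P x
update₂ s i ti k tk = update (update s i ti) k tk

module _ {n} {P : Fin n → Set} (s : (x : Fin n) → P x) (i : Fin n) (ti : P i) (k : Fin n) (tk : P k) where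

  update₂-fst : i ≢ k → update₂ s i ti k tk i ≡ ti
  update₂-fst i≢k = trans (update-other _ k tk i i≢k) (update-same s i ti)

  update₂-snd : update₂ s i ti k tk k ≡ tk
  update₂-snd = update-same _ k tk

  update₂-other : ∀ {x} → x ≢ i → x ≢ k → update₂ s i ti k tk x ≡ s x
  update₂-other {x} x≢i x≢k = trans (update-other _ k tk x x≢k) (update-other s i ti x x≢i)

∑ : ∀ {n} → (Fin n → ℕ) → ℕ
∑ {ℕ.zero}  g = 0
∑ {ℕ.suc n} g = g zero + ∑ (g ∘ suc)

∑-mono-≤ : ∀ {n} {g h : Fin n → ℕ} → (∀ x → g x ≤ h x) → ∑ g ≤ ∑ h
∑-mono-≤ {ℕ.zero}  g≤h = z≤n
∑-mono-≤ {ℕ.suc n} g≤h = ℕ.+-mono-≤ (g≤h zero) (∑-mono-≤ (g≤h ∘ suc))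

∑-mono-< : ∀ {n} {g h : Fin n → ℕ} → (∀ x → g x ≤ h x) → ∀ i → g i < h i → ∑ g < ∑ h
∑-mono-< g≤h zero    gi<hi = ℕ.+-mono-<-≤ gi<hi (∑-mono-≤ (g≤h ∘ suc))
∑-mono-< g≤h (suc i) gi<hi = ℕ.+-mono-≤-< (g≤h zero) (∑-mono-< (g≤h ∘ suc) i gi<hi)

update₂-decreases : ∀ {n} {P : Fin n → Set} (μ : (x : Fin n) → P x → ℕ) (s : (x : Fin n) → P x)
                    {i k ti tk} → i ≢ k → μ i ti < μ i (s i) → μ k tk ≤ μ k (s k) →
                    ∑ (λ x → μ x (update₂ s i ti k tk x)) < ∑ (λ x → μ x (s x))
update₂-decreases μ s {i} {k} {ti} {tk} i≢k lt-i le-k =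
  ∑-mono-< pointwise i (subst (λ t → μ i t < μ i (s i)) (sym (update₂-fst s i ti k tk i≢k)) lt-i)
  where
  pointwise : ∀ x → μ x (update₂ s i ti k tk x) ≤ μ x (s x)
  pointwise x with x Fin.≟ i | x Fin.≟ k
  ... | yes refl | _        =
    subst (λ t → μ x t ≤ μ x (s x)) (sym (update₂-fst s i ti k tk i≢k)) (ℕ.<⇒≤ lt-i)
  ... | no _     | yes refl = subst (λ t → μ x t ≤ μ x (s x)) (sym (update₂-snd s i ti k tk)) le-k
  ... | no x≢i   | no x≢k   = ℕ.≤-reflexive (cong (μ x) (update₂-other s i ti k tk x≢i x≢k))

all-or-some : ∀ {n} {P R : Fin n → Set} → (∀ i → P i ⊎ R i) → (∀ i → P i) ⊎ Σ[ i ∈ Fin n ] R i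
all-or-some {ℕ.zero}  _ = inj₁ λ ()
all-or-some {ℕ.suc n} h with h zero | all-or-some (h ∘ suc)
... | inj₂ r | _            = inj₂ (zero , r)
... | inj₁ p | inj₁ ps      = inj₁ λ { zero → p ; (suc i) → ps i }
... | inj₁ _ | inj₂ (i , r) = inj₂ (suc i , r)

module Product {n} (A : Fin n → CA 1) where

  State : Set
  State = Q (⊠ A)

  match-step : ∀ {s : State} {i k a ti tk} → i ≢ k →
               T (A i) (s i) (req₁ a) ti → T (A k) (s k) (off₁ a) tk →
               Σ[ l ∈ Label n ] (T (⊠ A) s l (update₂ s i ti k tk) × Match l)
  match-step {s} {i} {k} {a} {ti} {tk} i≢k step-i step-k = by-order (Fin.<-cmp i k)
    where
    l : Label n
    l = update₂ (λ _ → idle) i (req a) k (off a)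
    l-i : l i ≡ req a
    l-i = update₂-fst (λ _ → idle) i (req a) k (off a) i≢k
    l-k : l k ≡ off a
    l-k = update₂-snd (λ _ → idle) i (req a) k (off a)
    l-other : ∀ {x} → x ≢ i → x ≢ k → l x ≡ idle
    l-other = update₂-other (λ _ → idle) i (req a) k (off a)
    step-i′ : T (A i) (s i) (req₁ a) (update₂ s i ti k tk i)
    step-i′ = subst (T (A i) (s i) (req₁ a)) (sym (update₂-fst s i ti k tk i≢k)) step-i
    step-k′ : T (A k) (s k) (off₁ a) (update₂ s i ti k tk k)
    step-k′ = subst (T (A k) (s k) (off₁ a)) (sym (update₂-snd s i ti k tk)) step-k
    s-other : ∀ {x} → x ≢ i → x ≢ k → update₂ s i ti k tk x ≡ s x
    s-other = update₂-other s i ti k tk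
    by-order : Tri (i Fin.< k) (i ≡ k) (k Fin.< i) →
               Σ[ l ∈ Label n ] (T (⊠ A) s l (update₂ s i ti k tk) × Match l)
    by-order (tri< i<k _ _) =
      l , inj₁ (i , k , i<k , req₁ a , off₁ a , (a , inj₁ (requestOn-req₁ a , offerOn-off₁ a)) ,
                step-i′ , step-k′ , l-i , l-k , λ x x≢i x≢k → l-other x≢i x≢k , s-other x≢i x≢k) ,
      (i , k , i<k , req a , (λ ()) , l-i , l-k , λ x → l-other)
    by-order (tri≈ _ i≡k _) = ⊥-elim (i≢k i≡k)
    by-order (tri> _ _ k<i) =
      l , inj₁ (k , i , k<i , off₁ a , req₁ a , (a , inj₂ (offerOn-off₁ a , requestOn-req₁ a)) ,
                step-k′ , step-i′ , l-k , l-i , λ x x≢k x≢i → l-other x≢i x≢k , s-other x≢i x≢k) ,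
      (k , i , k<i , off a , (λ ()) , l-k , l-i , λ x x≢k x≢i → l-other x≢i x≢k)

  Offerable : State → Atom → Set
  Offerable s c = Σ[ k ∈ Fin n ] Σ[ b ∈ Label 1 ] Σ[ t ∈ Q (A k) ]
                  (T (A k) (s k) b t × b zero ≡ off c)

  data Move (s s' : State) (x : Fin n) : Set where
    stays : s' x ≡ s x → Move s s' x
    moves : ∀ {a} → T (A x) (s x) a (s' x) → (∀ {c} → a zero ≡ req c → Offerable s c) → Move s s' x

  agreeing-moves : ∀ {s l s'} → T (⊠ A) s l s' → Agreeing l → ∀ x → Move s s' x
  agreeing-moves (inj₁ (i , j , _ , a , b , a⋈b , step-i , step-j , _ , _ , others)) _ x
    with x Fin.≟ i | x Fin.≟ j
  ... | yes refl | _        = moves step-i λ e → j , b , _ , step-j , ⋈-request a⋈b e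
  ... | no _     | yes refl = moves step-j λ e → i , a , _ , step-i , ⋈-request (⋈-sym a⋈b) e
  ... | no x≢i   | no x≢j   = stays (proj₂ (others x x≢i x≢j))
  agreeing-moves (inj₂ (i , a , step-i , li , others , _)) agreeing x with x Fin.≟ i
  ... | yes refl = moves step-i λ e →
    ⊥-elim (agreeing-no-lone-request agreeing (trans li e) (λ k k≢i → proj₁ (others k k≢i)))
  ... | no x≢i   = stays (proj₂ (others x x≢i))

-- One Fix per ↠-conjunct, each cutting on the goal r.
assume-fix-consequents : ∀ (βs : List HAlpha) {Γ r} →
  (∀ {J u b nb} → hfix J u b nb ∈ βs → Γ ⊢ ⋀ (atoms J) ↠ atom b) →
  (∀ {J u b nb} → hfix J u b nb ∈ βs → ∀ {Δ} → Γ ⊆ Δ → (r ∷ Δ) ⊢ ⋀ (atoms J)) →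
  (∀ {Δ} → Γ ⊆ Δ → (∀ {J u b nb} → hfix J u b nb ∈ βs → Δ ⊢ atom b) → Δ ⊢ r) →
  Γ ⊢ r
assume-fix-consequents [] premise antecedent conclude = conclude ⊆-refl λ ()
assume-fix-consequents (hfix J u b nb ∷ βs) premise antecedent conclude =
  ↠-elim (premise (here refl)) (antecedent (here refl) ⊆-refl)
    (assume-fix-consequents βs (λ m → weaken there (premise (there m)))
      (λ m bΓ⊆Δ → antecedent (there m) (λ x∈ → bΓ⊆Δ (there x∈)))
      (λ bΓ⊆Δ heads → conclude (λ x∈ → bΓ⊆Δ (there x∈))
        λ { (here refl) → id (bΓ⊆Δ (here refl)) ; (there m) → heads m }))
assume-fix-consequents (hconj J u ∷ βs) premise antecedent conclude =
  assume-fix-consequents βs (premise ∘ there) (antecedent ∘ there)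
    (λ Γ⊆Δ heads → conclude Γ⊆Δ λ { (there m) → heads m })
assume-fix-consequents (himp J u b nb ∷ βs) premise antecedent conclude =
  assume-fix-consequents βs (premise ∘ there) (antecedent ∘ there)
    (λ Γ⊆Δ heads → conclude Γ⊆Δ λ { (there m) → heads m })

module Conjunction (αs : List HAlpha) where

  n : ℕ
  n = length αs

  conjunct : Fin n → HAlpha
  conjunct = List.lookup αs

  component : Fin n → CA 1
  component k = ⟦ conjunct k ⟧CAα

  open Product component

  allAtoms : List Atom
  allAtoms = concatMap atomsα αs

  requested∈allAtoms : ∀ x {a} → a ∈ requests (conjunct x) → a ∈ allAtoms
  requested∈allAtoms x a∈ =
    ∈-concatMap⁺ atomsα (Any.map (λ { refl → requests⊆atomsα _ a∈ }) (∈-lookup {xs = αs} x))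

  data Derivable : Atom → Set where
    conj : ∀ {a} k {J u} → conjunct k ≡ hconj J u → a ∈ toList J → Derivable a
    imp  : ∀ {b} k {J u nb} → conjunct k ≡ himp J u b nb →
           (∀ {a} → a ∈ toList J → Derivable a) → Derivable b
    fix  : ∀ {b} k {J u nb} → conjunct k ≡ hfix J u b nb → Derivable b

  derivable-closed : ∀ k → Closed Derivable (conjunct k)
  derivable-closed k with conjunct k in eq
  ... | hconj _ _    = conj k eq
  ... | himp _ _ _ _ = imp k eq
  ... | hfix _ _ _ _ = fix k eq

  Premise : Ctx
  Premise = [ ⋀ (map ⟦_⟧α αs) ]

  Goal : Formula
  Goal = ⋀ (map atom allAtoms)

  derivable-of-provable : Premise ⊢ Goal → ∀ {a} → a ∈ allAtoms → Derivable a
  derivable-of-provable d = V.⋀-atoms-valid⁻ allAtoms (V.sound d premise-valid)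
    where
    module V = Valuation Derivable
    premise-valid : V.Valid Premise
    premise-valid (here refl) = V.⋀-valid⁺ (map ⟦_⟧α αs) λ p∈ → case ∈-map⁻ ⟦_⟧α p∈ of λ where
      (α , α∈ , refl) → subst (λ β → V.⟦ ⟦ β ⟧α ⟧) (sym (lookup-index α∈))
                          (closed-valid (conjunct (Any.index α∈)) (derivable-closed (Any.index α∈)))

  derivable-provable : ∀ {Δ} → (∀ k → Δ ⊢ ⟦ conjunct k ⟧α) →
                       (∀ k {J u b nb} → conjunct k ≡ hfix J u b nb → Δ ⊢ atom b) →
                       ∀ {a} → Derivable a → Δ ⊢ atom a
  derivable-provable {Δ} conjuncts heads (conj k {J} eq a∈) =
    ⋀-atoms-elim (toList J) (subst (λ α → Δ ⊢ ⟦ α ⟧α) eq (conjuncts k)) a∈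
  derivable-provable {Δ} conjuncts heads (imp k {J} eq below) =
    ⇒-elim (subst (λ α → Δ ⊢ ⟦ α ⟧α) eq (conjuncts k))
           (⋀-atoms-intro (toList J) λ a∈ → derivable-provable conjuncts heads (below a∈))
  derivable-provable conjuncts heads (fix k eq) = heads k eq

  provable-of-derivable : (∀ {a} → a ∈ allAtoms → Derivable a) → Premise ⊢ Goal
  provable-of-derivable derivable =
    assume-fix-consequents αs (conjunct-provable ⊆-refl) antecedent conclude
    where
    conjunct-provable : ∀ {Δ α} → Premise ⊆ Δ → α ∈ αs → Δ ⊢ ⟦ α ⟧α
    conjunct-provable P⊆Δ α∈ = ⋀-elim (map ⟦_⟧α αs) (id (P⊆Δ (here refl))) (∈-map⁺ ⟦_⟧α α∈)
    antecedent : ∀ {J u b nb} → hfix J u b nb ∈ αs → ∀ {Δ} → Premise ⊆ Δ → (Goal ∷ Δ) ⊢ ⋀ (atoms J)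
    antecedent {J} α∈ _ = ⋀-atoms-intro (toList J) λ a∈ →
      ⋀-atoms-elim allAtoms (id (here refl)) (∈-concatMap⁺ atomsα (Any.map (λ { refl → ∈-++⁺ˡ a∈ }) α∈))
    conclude : ∀ {Δ} → Premise ⊆ Δ → (∀ {J u b nb} → hfix J u b nb ∈ αs → Δ ⊢ atom b) → Δ ⊢ Goal
    conclude P⊆Δ heads = ⋀-atoms-intro allAtoms λ a∈ →
      derivable-provable (λ k → conjunct-provable P⊆Δ (∈-lookup {xs = αs} k))
                         (λ k eq → heads (subst (_∈ αs) eq (∈-lookup {xs = αs} k))) (derivable a∈)

  total : State → ℕ
  total s = ∑ λ x → pending (conjunct x) (s x)

  Progress : State → Set
  Progress s = Σ[ l ∈ Label n ] Σ[ s' ∈ State ] (T (⊠ component) s l s' × Match l × total s' < total s)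

  progress : ∀ {s : State} {i k a} → i ≢ k → RequestStep (conjunct i) (s i) a →
             OfferStep (conjunct k) (s k) a → Progress s
  progress {s} {i} {k} i≢k (ti , step-i , lt) (tk , step-k , le) =
    let (l , t , match) = match-step i≢k step-i step-k in
    l , update₂ s i ti k tk , t , match , update₂-decreases (λ x → pending (conjunct x)) s i≢k lt le

  distinct : ∀ {a i k} → a ∈ requests (conjunct i) → a ∉ requests (conjunct k) → i ≢ k
  distinct a∈ a∉ refl = a∉ a∈

  -- A →-conjunct offers its consequent only once all its requests are granted; these are derivable
  -- by a smaller derivation, so they are served first.
  serve : (s : State) → ∀ {a} → Derivable a → ∀ i → a ∈ requests (conjunct i) →
          RequestStep (conjunct i) (s i) a → Progress s
  serve s (conj k eq a∈J) i a∈ step =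
    progress (distinct a∈ λ a∈' → case subst (_ ∈_) (cong requests eq) a∈' of λ ())
             step (conj-offer eq a∈J (s k))
  serve s (fix k {nb = b∉J} eq) i a∈ step =
    progress (distinct a∈ (b∉J ∘ subst (_ ∈_) (cong requests eq))) step (fix-offer eq (s k))
  serve s (imp k {nb = b∉J} eq below) i a∈ step with next-request (conjunct k) (s k)
  ... | inj₁ final =
    progress (distinct a∈ (b∉J ∘ subst (_ ∈_) (cong requests eq))) step (imp-offer eq (s k) final)
  ... | inj₂ (a' , a'∈ , step') = serve s (below (subst (a' ∈_) (cong requests eq) a'∈)) k a'∈ step'

  Run : State → Set
  Run s = Σ[ w ∈ List (Label n) ] Σ[ s' ∈ State ]
          (Path (⊠ component) s w s' × F (⊠ component) s' × All Agreeing w)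

  run : (∀ x {a} → a ∈ requests (conjunct x) → Derivable a) → (s : State) → Acc _<_ (total s) → Run s
  run derivable s (acc smaller) with all-or-some (λ x → next-request (conjunct x) (s x))
  ... | inj₁ final = [] , s , [] , final , []
  ... | inj₂ (x , a , a∈ , step) with serve s (derivable x a∈) x a∈ step
  ...   | (l , s' , t , match , decreases) with run derivable s' (smaller decreases)
  ...     | (w , s'' , path , final , agreeing) =
    l ∷ w , s'' , t ∷ path , final , (τ , obsMatch match , tau) ∷ agreeing

  Fulfilled-all : State → Set
  Fulfilled-all s = ∀ x → Fulfilled Derivable (conjunct x) (s x)

  fulfilled-transition : ∀ {s l s'} → T (⊠ component) s l s' → Agreeing l →
                         Fulfilled-all s → Fulfilled-all s'
  fulfilled-transition t agreeing fulfilled x with agreeing-moves t agreeing x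
  ... | stays e = subst (Fulfilled Derivable (conjunct x)) (sym e) (fulfilled x)
  ... | moves step offerable = fulfilled-step (conjunct x) step (fulfilled x) λ e →
    let (k , _ , _ , step-k , off-c) = offerable e in
    offer-closed (conjunct k) (derivable-closed k) (fulfilled k) step-k off-c

  fulfilled-path : ∀ {s w s'} → Path (⊠ component) s w s' → All Agreeing w →
                   Fulfilled-all s → Fulfilled-all s'
  fulfilled-path []       []                     fulfilled = fulfilled
  fulfilled-path (t ∷ ts) (agreeing ∷ agreeings) fulfilled =
    fulfilled-path ts agreeings (fulfilled-transition t agreeing fulfilled)

  derivable-of-agreement : ∀ {w s} → Path (⊠ component) (q0 (⊠ component)) w s →
                           F (⊠ component) s → All Agreeing w → ∀ {a} → a ∈ allAtoms → Derivable a
  derivable-of-agreement path final agreeing a∈ =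
    let α∈ = ∈-concatMap⁻ atomsα {xs = αs} a∈ ; k = Any.index α∈ in
    atoms-closed (conjunct k) (derivable-closed k)
      (fulfilled-path path agreeing (λ x → fulfilled-initial Derivable (conjunct x)) k)
      (final k) (lookup-index α∈)

theorem5p6 : (p : HPCL) → ([ toPCL p ] ⊢ λp p) ⇔ AdmitsAgreement ⟦ p ⟧CA
theorem5p6 p = mk⇔ agreement-of-proof proof-of-agreement
  where
  open Conjunction (alphas p)

  agreement-of-proof : Premise ⊢ Goal → AdmitsAgreement ⟦ p ⟧CA
  agreement-of-proof d =
    let requested-derivable = λ x {a} a∈ → derivable-of-provable d (requested∈allAtoms x {a} a∈)
        (w , s , path , final , agreeing) = run requested-derivable (q0 ⟦ p ⟧CA) (<-wellFounded _)
    in w , (s , path , final) , two≤ p , agreeing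

  proof-of-agreement : AdmitsAgreement ⟦ p ⟧CA → Premise ⊢ Goal
  proof-of-agreement (w , (s , path , final) , _ , agreeing) =
    provable-of-derivable (derivable-of-agreement path final agreeing)
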